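{- Let $n\ge 1$ and $0\le k\le n$ be integers, and let $F$ be a $k$-homogeneous $(n,m)$-function. Then $F$ is $k$th-order sum-free if and only if its complement $\overline{F}$ is $(n-k)$th-order sum-free.
   Context: An $(n,m)$-function is a map $F\colon\mathbb{F}_2^n\to\mathbb{F}_2^m$, given by its coordinate Boolean functions $f_1,\dots,f_m$, each written in algebraic normal form (ANF) as a sum of distinct monomials $x_I=\prod_{i\in I}x_i$, $I\subseteq[n]=\{1,\dots,n\}$. $F$ is $k$-homogeneous if the ANFs of all its coordinate functions contain only monomials of degree $k$. For a monomial $x_I$, its complement is $\overline{x_I}=x_{[n]\setminus I}$; for a Boolean function $f=m_1+\dots+m_t$ (sum of distinct monomials in ANF) its complement is $\overline{f}=\overline{m_1}+\dots+\overline{m_t}$; the complement $\overline{F}$ of $F$ is the $(n,m)$-function with coordinate functions $\overline{f_1},\dots,\overline{f_m}$. A $k$-flat is a set $U+a$ with $U$ a $k$-dimensional linear subspace of $\mathbb{F}_2^n$ and $a\in\mathbb{F}_2^n$. A $k$-flat $A$ is vanishing for $F$ if $\sum_{x\in A}F(x)=0$, and nonvanishing otherwise. $F$ is called $k$th-order sum-free if it has no vanishing $k$-flats. -}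

module Defs where

open import Data.Nat using (ℕ; zero; suc)
open import Data.Bool using (Bool; true; false; _∧_; _∨_; _xor_; not; if_then_else_)
open import Data.List using (List; []; _∷_; _++_; foldr)
import Data.List as L
open import Data.Vec using (Vec; []; _∷_; zipWith; replicate; lookup)
import Data.Vec as V
open import Data.Fin using (Fin)
open import Data.Product using (Σ; _×_)
open import Relation.Binary.PropositionalEquality using (_≡_)
open import Relation.Nullary using (¬_)

F2^ : ℕ → Set
F2^ n = Vec Bool n

allVecs : (n : ℕ) → List (F2^ n)
allVecs zero    = [] ∷ []
allVecs (suc n) = L.map (false ∷_) (allVecs n) ++ L.map (true ∷_) (allVecs n)

_⊕_ : {n : ℕ} → F2^ n → F2^ n → F2^ n
_⊕_ = zipWith _xor_

𝟎 : {n : ℕ} → F2^ n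
𝟎 = replicate _ false

vsum : {n : ℕ} → List (F2^ n) → F2^ n
vsum = foldr _⊕_ 𝟎

-- A subset I ⊆ [n] is represented by its indicator vector; the monomial x_I.
monomial : {n : ℕ} → F2^ n → F2^ n → Bool
monomial I x = V.foldr _ _∧_ true (zipWith (λ i xi → not i ∨ xi) I x)

weight : {n : ℕ} → F2^ n → ℕ
weight []          = zero
weight (true ∷ v)  = suc (weight v)
weight (false ∷ v) = weight v

-- A Boolean function in ANF: its coefficient on each monomial x_I
-- (true iff x_I occurs).  This represents sums of DISTINCT monomials exactly.
ANF : ℕ → Set
ANF n = F2^ n → Bool

evalANF : {n : ℕ} → ANF n → F2^ n → Bool
evalANF {n} f x = foldr _xor_ false (L.map (λ I → f I ∧ monomial I x) (allVecs n))

VFun : ℕ → ℕ → Set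
VFun n m = Vec (ANF n) m

eval : {n m : ℕ} → VFun n m → F2^ n → F2^ m
eval F x = V.map (λ f → evalANF f x) F

-- Complement: the monomial x_I is replaced by x_{[n]∖I}.
complANF : {n : ℕ} → ANF n → ANF n
complANF f I = f (V.map not I)

complement : {n m : ℕ} → VFun n m → VFun n m
complement = V.map complANF

Homogeneous : {n m : ℕ} → ℕ → VFun n m → Set
Homogeneous {n} {m} k F = (j : Fin m) (I : F2^ n) → lookup F j I ≡ true → weight I ≡ k

linComb : {n k : ℕ} → F2^ k → Vec (F2^ n) k → F2^ n
linComb c vs = V.foldr _ _⊕_ 𝟎 (zipWith (λ ci v → if ci then v else 𝟎) c vs)

LinIndep : {n k : ℕ} → Vec (F2^ n) k → Set
LinIndep {n} {k} vs = (c : F2^ k) → linComb c vs ≡ 𝟎 → c ≡ 𝟎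

-- A k-flat U + a, U = span(v_1,…,v_k) with the v_i linearly independent
-- (so c ↦ a + Σ c_i v_i is a bijection F₂^k → U + a).
-- Sum of F over the flat:
flatSum : {n m k : ℕ} → VFun n m → F2^ n → Vec (F2^ n) k → F2^ m
flatSum {k = k} F a vs = vsum (L.map (λ c → eval F (a ⊕ linComb c vs)) (allVecs k))

SumFree : {n m : ℕ} → ℕ → VFun n m → Set
SumFree {n} k F = (a : F2^ n) (vs : Vec (F2^ n) k) → LinIndep vs → ¬ (flatSum F a vs ≡ 𝟎)

{-# OPTIONS --safe #-}
module Submission where

-- For |I| = k and k vectors vs, the sum of the monomial x_I over the flat a + span vs is a
-- k-th order derivative of x_I; since deg x_I = k it does not depend on a, and it equals the
-- k × k minor of vs on the columns I, a Plücker coordinate of span vs.  Hence the sum of a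
-- k-homogeneous F over a k-flat depends only on the Plücker coordinates of its direction, and
-- the sum of F̄ over an (n − k)-flat only on those of its direction read on complementary
-- columns.  Every independent k-tuple has an independent (n − k)-tuple (spanning the orthogonal
-- complement) whose Plücker coordinate on [n] ∖ I is the one of the k-tuple on I, and vice
-- versa, so F has a vanishing k-flat iff F̄ has a vanishing (n − k)-flat.  The dual tuple is
-- built by induction on n after clearing the first column by row operations: a zero column
-- adds e₁ to the dual, and a pivot row (1, u) above rows (0, U) sends the dual V of U to
-- {(u · v, v) | v ∈ V}.  The identities between minors this needs are Laplace expansions,
-- proved like the first fact by counting degrees.

open import Algebra.Bundles using (CommutativeMonoid)
import Algebra.Properties.CommutativeSemigroup as CommutativeSemigroupProperties
open import Data.Bool using (Bool; true; false; _∧_; _xor_; not; if_then_else_)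
open import Data.Bool.Properties
  using (xor-assoc; xor-comm; xor-identityˡ; xor-identityʳ; xor-same; ∧-comm; ∧-zeroʳ; ∧-identityʳ; ∧-idem;
         not-involutive)
open import Data.Bool.Solver using (module xor-∧-Solver)
open import Data.Fin using (zero; suc)
open import Data.List using (List; []; _∷_; _++_; foldr)
import Data.List as L
import Data.List.Properties as LP
open import Data.Nat using (ℕ; zero; suc; pred; _≤_; z≤n; _+_; _∸_)
open import Data.Nat.Properties
  using (pred-mono-≤; ≤-refl; +-suc; +-comm; +-cancelˡ-≡; +-cancelʳ-≡; suc-injective; m∸n+n≡m; m+[n∸m]≡n)
open import Data.Product using (_,_; _×_; ∃-syntax)
open import Data.Sum using (_⊎_; inj₁; inj₂)
open import Data.Vec using (Vec; []; _∷_; head; tail)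
import Data.Vec as V
open import Data.Vec.Properties
  using (zipWith-assoc; zipWith-comm; zipWith-identityˡ; zipWith-identityʳ; map-cong; map-∘)
open import Function using (_∘_)
open import Function.Bundles using (_⇔_; mk⇔)
open import Relation.Binary.PropositionalEquality

open import Defs

open xor-∧-Solver using (solve; _:+_; _:*_; _:=_; con)

private
  variable
    n m k d : ℕ

-- Linear algebra over F₂

⊕-assoc : (x y z : F2^ n) → (x ⊕ y) ⊕ z ≡ x ⊕ (y ⊕ z)
⊕-assoc = zipWith-assoc xor-assoc

⊕-comm : (x y : F2^ n) → x ⊕ y ≡ y ⊕ x
⊕-comm = zipWith-comm xor-comm

⊕-identityˡ : (x : F2^ n) → 𝟎 ⊕ x ≡ x
⊕-identityˡ = zipWith-identityˡ xor-identityˡ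

⊕-identityʳ : (x : F2^ n) → x ⊕ 𝟎 ≡ x
⊕-identityʳ = zipWith-identityʳ xor-identityʳ

⊕-self : (x : F2^ n) → x ⊕ x ≡ 𝟎
⊕-self []      = refl
⊕-self (b ∷ x) = cong₂ _∷_ (xor-same b) (⊕-self x)

⊕-cancelʳ : (x y : F2^ n) → (x ⊕ y) ⊕ y ≡ x
⊕-cancelʳ x y = begin
  (x ⊕ y) ⊕ y  ≡⟨ ⊕-assoc x y y ⟩
  x ⊕ (y ⊕ y)  ≡⟨ cong (x ⊕_) (⊕-self y) ⟩
  x ⊕ 𝟎        ≡⟨ ⊕-identityʳ x ⟩
  x            ∎
  where open ≡-Reasoning

⊕-commutativeMonoid : ℕ → CommutativeMonoid _ _
⊕-commutativeMonoid n = record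
  { Carrier             = F2^ n
  ; _≈_                 = _≡_
  ; _∙_                 = _⊕_
  ; ε                   = 𝟎
  ; isCommutativeMonoid = record
    { isMonoid = record
      { isSemigroup = record
        { isMagma = record { isEquivalence = isEquivalence ; ∙-cong = cong₂ _⊕_ }
        ; assoc   = ⊕-assoc
        }
      ; identity    = ⊕-identityˡ , ⊕-identityʳ
      }
    ; comm     = ⊕-comm
    }
  }

module ⊕-Properties {n : ℕ} =
  CommutativeSemigroupProperties (CommutativeMonoid.commutativeSemigroup (⊕-commutativeMonoid n))

open ⊕-Properties using (interchange; xy∙z≈xz∙y)

F2^0-trivial : (x y : F2^ 0) → x ≡ y
F2^0-trivial [] [] = refl

infix 30 _·_

_·_ : Bool → F2^ n → F2^ n
b · v = if b then v else 𝟎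

·-distribʳ-xor : (b c : Bool) (v : F2^ n) → (b xor c) · v ≡ b · v ⊕ c · v
·-distribʳ-xor true  true  v = sym (⊕-self v)
·-distribʳ-xor true  false v = sym (⊕-identityʳ v)
·-distribʳ-xor false c     v = sym (⊕-identityˡ (c · v))

IsLinear : (F2^ n → F2^ m) → Set
IsLinear φ = ∀ x y → φ (x ⊕ y) ≡ φ x ⊕ φ y

IsLinearForm : (F2^ n → Bool) → Set
IsLinearForm β = ∀ x y → β (x ⊕ y) ≡ β x xor β y

module _ {φ : F2^ n → F2^ m} (φ-linear : IsLinear φ) where

  linear-𝟎 : φ 𝟎 ≡ 𝟎
  linear-𝟎 = begin
    φ 𝟎        ≡⟨ cong φ (sym (⊕-identityˡ 𝟎)) ⟩
    φ (𝟎 ⊕ 𝟎)  ≡⟨ φ-linear 𝟎 𝟎 ⟩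
    φ 𝟎 ⊕ φ 𝟎  ≡⟨ ⊕-self (φ 𝟎) ⟩
    𝟎          ∎
    where open ≡-Reasoning

  linear-· : ∀ b v → φ (b · v) ≡ b · φ v
  linear-· true  v = refl
  linear-· false v = linear-𝟎

  linComb-map : (c : F2^ k) (vs : Vec (F2^ n) k) → linComb c (V.map φ vs) ≡ φ (linComb c vs)
  linComb-map []      []       = sym linear-𝟎
  linComb-map (b ∷ c) (v ∷ vs) = begin
    b · φ v ⊕ linComb c (V.map φ vs)  ≡⟨ cong₂ _⊕_ (sym (linear-· b v)) (linComb-map c vs) ⟩
    φ (b · v) ⊕ φ (linComb c vs)      ≡⟨ sym (φ-linear (b · v) (linComb c vs)) ⟩
    φ (b · v ⊕ linComb c vs)          ∎
    where open ≡-Reasoning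

  LinIndep-map⁻ : {vs : Vec (F2^ n) k} → LinIndep (V.map φ vs) → LinIndep vs
  LinIndep-map⁻ {vs = vs} ind c eq = ind c (trans (linComb-map c vs) (trans (cong φ eq) linear-𝟎))

  LinIndep-map : (∀ x → φ x ≡ 𝟎 → x ≡ 𝟎) → {vs : Vec (F2^ n) k} →
                 LinIndep vs → LinIndep (V.map φ vs)
  LinIndep-map φ-injective {vs} ind c eq = ind c (φ-injective _ (trans (sym (linComb-map c vs)) eq))

linearForm-𝟎 : (β : F2^ n → Bool) → IsLinearForm β → β 𝟎 ≡ false
linearForm-𝟎 β β-linear = begin
  β 𝟎          ≡⟨ cong β (sym (⊕-identityˡ 𝟎)) ⟩
  β (𝟎 ⊕ 𝟎)    ≡⟨ β-linear 𝟎 𝟎 ⟩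
  β 𝟎 xor β 𝟎  ≡⟨ xor-same (β 𝟎) ⟩
  false        ∎
  where open ≡-Reasoning

head-linear : IsLinearForm (head {n = n})
head-linear (x ∷ xs) (y ∷ ys) = refl

dot : F2^ n → F2^ n → Bool
dot []       []       = false
dot (u ∷ us) (x ∷ xs) = (u ∧ x) xor dot us xs

dot-linear : (u : F2^ n) → IsLinearForm (dot u)
dot-linear []       []       []       = refl
dot-linear (u ∷ us) (x ∷ xs) (y ∷ ys) =
  trans (cong ((u ∧ (x xor y)) xor_) (dot-linear us xs ys))
        (solve 5 (λ u x y p q → (u :* (x :+ y)) :+ (p :+ q) := ((u :* x) :+ p) :+ ((u :* y) :+ q))
               refl u x y (dot us xs) (dot us ys))

linComb-𝟎 : (vs : Vec (F2^ n) k) → linComb 𝟎 vs ≡ 𝟎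
linComb-𝟎 []       = refl
linComb-𝟎 (v ∷ vs) = trans (⊕-identityˡ _) (linComb-𝟎 vs)

linComb-⊕ : (c c′ : F2^ k) (vs : Vec (F2^ n) k) → linComb (c ⊕ c′) vs ≡ linComb c vs ⊕ linComb c′ vs
linComb-⊕ []      []        []       = sym (⊕-identityˡ 𝟎)
linComb-⊕ (b ∷ c) (b′ ∷ c′) (v ∷ vs) = begin
  (b xor b′) · v ⊕ linComb (c ⊕ c′) vs
    ≡⟨ cong₂ _⊕_ (·-distribʳ-xor b b′ v) (linComb-⊕ c c′ vs) ⟩
  (b · v ⊕ b′ · v) ⊕ (linComb c vs ⊕ linComb c′ vs)
    ≡⟨ interchange _ _ _ _ ⟩
  (b · v ⊕ linComb c vs) ⊕ (b′ · v ⊕ linComb c′ vs)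
    ∎
  where open ≡-Reasoning

LinIndep-∷⁻ : {w : F2^ n} {ws : Vec (F2^ n) k} → LinIndep (w ∷ ws) → LinIndep ws
LinIndep-∷⁻ ind c eq = cong tail (ind (false ∷ c) (trans (⊕-identityˡ _) eq))

LinIndep-add : {w : F2^ n} {ws : Vec (F2^ n) k} (s : F2^ k) →
               LinIndep (w ∷ ws) → LinIndep ((w ⊕ linComb s ws) ∷ ws)
LinIndep-add s ind (false ∷ c) eq = ind (false ∷ c) eq
LinIndep-add {w = w} {ws} s ind (true ∷ c) eq with ind (true ∷ (s ⊕ c)) eq′
  where
  eq′ : w ⊕ linComb (s ⊕ c) ws ≡ 𝟎
  eq′ = trans (cong (w ⊕_) (linComb-⊕ s c ws)) (trans (sym (⊕-assoc w _ _)) eq)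
... | ()

shear : (F2^ n → Bool) → F2^ n → F2^ n → F2^ n
shear β w v = v ⊕ β v · w

shear-linear : {β : F2^ n → Bool} → IsLinearForm β → ∀ w → IsLinear (shear β w)
shear-linear {β = β} β-linear w x y = begin
  (x ⊕ y) ⊕ β (x ⊕ y) · w        ≡⟨ cong (λ b → (x ⊕ y) ⊕ b · w) (β-linear x y) ⟩
  (x ⊕ y) ⊕ (β x xor β y) · w    ≡⟨ cong ((x ⊕ y) ⊕_) (·-distribʳ-xor (β x) (β y) w) ⟩
  (x ⊕ y) ⊕ (β x · w ⊕ β y · w)  ≡⟨ interchange x y _ _ ⟩
  (x ⊕ β x · w) ⊕ (y ⊕ β y · w)  ∎
  where open ≡-Reasoning

LinIndep-shear : {β : F2^ n → Bool} → IsLinearForm β → {w : F2^ n} {ws : Vec (F2^ n) k} →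
                 LinIndep (w ∷ ws) → LinIndep (w ∷ V.map (shear β w) ws)
LinIndep-shear {n = n} {β = β} β-linear {w} {ws} ind (c₀ ∷ c) eq = cong₂ _∷_ c₀≡false c≡𝟎
  where
  open ≡-Reasoning
  x : F2^ n
  x = linComb c ws
  shear-lin : IsLinear (shear β w)
  shear-lin = shear-linear β-linear w
  eq′ : (c₀ xor β x) · w ⊕ x ≡ 𝟎
  eq′ = begin
    (c₀ xor β x) · w ⊕ x                       ≡⟨ cong (_⊕ x) (·-distribʳ-xor c₀ (β x) w) ⟩
    (c₀ · w ⊕ β x · w) ⊕ x                     ≡⟨ xy∙z≈xz∙y _ _ _ ⟩
    (c₀ · w ⊕ x) ⊕ β x · w                     ≡⟨ ⊕-assoc _ _ _ ⟩
    c₀ · w ⊕ shear β w x                       ≡⟨ cong (c₀ · w ⊕_) (sym (linComb-map shear-lin c ws)) ⟩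
    c₀ · w ⊕ linComb c (V.map (shear β w) ws)  ≡⟨ eq ⟩
    𝟎                                          ∎
  c≡𝟎 : c ≡ 𝟎
  c≡𝟎 = cong tail (ind ((c₀ xor β x) ∷ c) eq′)
  x≡𝟎 : x ≡ 𝟎
  x≡𝟎 = trans (cong (λ c′ → linComb c′ ws) c≡𝟎) (linComb-𝟎 ws)
  c₀≡false : c₀ ≡ false
  c₀≡false = begin
    c₀            ≡⟨ sym (xor-identityʳ c₀) ⟩
    c₀ xor false  ≡⟨ cong (c₀ xor_) (sym (trans (cong β x≡𝟎) (linearForm-𝟎 β β-linear))) ⟩
    c₀ xor β x    ≡⟨ cong head (ind ((c₀ xor β x) ∷ c) eq′) ⟩
    false         ∎

-- Higher-order derivatives

∂ : F2^ n → (F2^ n → Bool) → F2^ n → Bool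
∂ w g x = g x xor g (x ⊕ w)

-- Δ vs g a = ∂_{v₁} ⋯ ∂_{v_k} g (a), the sum of g over the flat a + span vs (⨁-flat).
Δ : Vec (F2^ n) k → (F2^ n → Bool) → F2^ n → Bool
Δ []       g a = g a
Δ (v ∷ vs) g a = Δ vs g a xor Δ vs g (a ⊕ v)

∂-periodic : (g : F2^ n → Bool) (w x : F2^ n) → ∂ w g (x ⊕ w) ≡ ∂ w g x
∂-periodic g w x = trans (cong (g (x ⊕ w) xor_) (cong g (⊕-cancelʳ x w))) (xor-comm (g (x ⊕ w)) (g x))

Δ-cong : {g h : F2^ n → Bool} → (∀ x → g x ≡ h x) → (vs : Vec (F2^ n) k) (a : F2^ n) →
         Δ vs g a ≡ Δ vs h a
Δ-cong g≗h []       a = g≗h a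
Δ-cong g≗h (v ∷ vs) a = cong₂ _xor_ (Δ-cong g≗h vs a) (Δ-cong g≗h vs (a ⊕ v))

Δ-xor : (g h : F2^ n → Bool) (vs : Vec (F2^ n) k) (a : F2^ n) →
        Δ vs (λ x → g x xor h x) a ≡ Δ vs g a xor Δ vs h a
Δ-xor g h []       a = refl
Δ-xor g h (v ∷ vs) a =
  trans (cong₂ _xor_ (Δ-xor g h vs a) (Δ-xor g h vs (a ⊕ v)))
        (solve 4 (λ p q r s → (p :+ q) :+ (r :+ s) := (p :+ r) :+ (q :+ s))
               refl (Δ vs g a) (Δ vs h a) (Δ vs g (a ⊕ v)) (Δ vs h (a ⊕ v)))

Δ-false : (vs : Vec (F2^ n) k) (a : F2^ n) → Δ vs (λ _ → false) a ≡ false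
Δ-false []       a = refl
Δ-false (v ∷ vs) a = cong₂ _xor_ (Δ-false vs a) (Δ-false vs (a ⊕ v))

Δ-∧ˡ : (b : Bool) (g : F2^ n → Bool) (vs : Vec (F2^ n) k) (a : F2^ n) →
       Δ vs (λ x → b ∧ g x) a ≡ b ∧ Δ vs g a
Δ-∧ˡ true  g vs a = refl
Δ-∧ˡ false g vs a = Δ-false vs a

Δ-shift : (g : F2^ n → Bool) (vs : Vec (F2^ n) k) (a w : F2^ n) →
          Δ vs g (a ⊕ w) ≡ Δ vs (λ x → g (x ⊕ w)) a
Δ-shift g []       a w = refl
Δ-shift g (v ∷ vs) a w =
  cong₂ _xor_ (Δ-shift g vs a w) (trans (cong (Δ vs g) (xy∙z≈xz∙y a w v)) (Δ-shift g vs (a ⊕ v) w))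

Δ-∷ : (g : F2^ n → Bool) (w : F2^ n) (vs : Vec (F2^ n) k) (a : F2^ n) → Δ (w ∷ vs) g a ≡ Δ vs (∂ w g) a
Δ-∷ g w vs a = trans (cong (Δ vs g a xor_) (Δ-shift g vs a w)) (sym (Δ-xor g (λ x → g (x ⊕ w)) vs a))

Δ-periodic : {g : F2^ n → Bool} {w : F2^ n} → (∀ x → g (x ⊕ w) ≡ g x) →
             (vs : Vec (F2^ n) k) (b : Bool) (a : F2^ n) → Δ vs g (a ⊕ b · w) ≡ Δ vs g a
Δ-periodic {g = g} {w} periodic vs true  a = trans (Δ-shift g vs a w) (Δ-cong periodic vs a)
Δ-periodic             periodic vs false a = cong (Δ vs _) (⊕-identityʳ a)

Δ-translate-span : (g : F2^ n → Bool) (s : F2^ k) (vs : Vec (F2^ n) k) (a : F2^ n) →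
                   Δ vs g (a ⊕ linComb s vs) ≡ Δ vs g a
Δ-translate-span g []      []       a = cong g (⊕-identityʳ a)
Δ-translate-span g (t ∷ s) (w ∷ ws) a = begin
  Δ (w ∷ ws) g (a ⊕ (t · w ⊕ linComb s ws))  ≡⟨ cong (Δ (w ∷ ws) g) (sym (⊕-assoc a _ _)) ⟩
  Δ (w ∷ ws) g ((a ⊕ t · w) ⊕ linComb s ws)  ≡⟨ Δ-∷ g w ws _ ⟩
  Δ ws (∂ w g) ((a ⊕ t · w) ⊕ linComb s ws)  ≡⟨ Δ-translate-span (∂ w g) s ws (a ⊕ t · w) ⟩
  Δ ws (∂ w g) (a ⊕ t · w)                   ≡⟨ Δ-periodic (∂-periodic g w) ws t a ⟩
  Δ ws (∂ w g) a                             ≡⟨ sym (Δ-∷ g w ws a) ⟩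
  Δ (w ∷ ws) g a                             ∎
  where open ≡-Reasoning

Δ-add : (g : F2^ n → Bool) (w : F2^ n) (s : F2^ k) (ws : Vec (F2^ n) k) (a : F2^ n) →
        Δ ((w ⊕ linComb s ws) ∷ ws) g a ≡ Δ (w ∷ ws) g a
Δ-add g w s ws a = cong (Δ ws g a xor_)
  (trans (cong (Δ ws g) (sym (⊕-assoc a w _))) (Δ-translate-span g s ws (a ⊕ w)))

Δ-map-shear : {g : F2^ n → Bool} {w : F2^ n} → (∀ x → g (x ⊕ w) ≡ g x) → (β : F2^ n → Bool) →
              (vs : Vec (F2^ n) k) (a : F2^ n) → Δ (V.map (shear β w) vs) g a ≡ Δ vs g a
Δ-map-shear periodic β []       a = refl
Δ-map-shear {g = g} {w} periodic β (v ∷ vs) a = cong₂ _xor_ (Δ-map-shear periodic β vs a) (begin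
  Δ (V.map (shear β w) vs) g (a ⊕ (v ⊕ β v · w))  ≡⟨ Δ-map-shear periodic β vs _ ⟩
  Δ vs g (a ⊕ (v ⊕ β v · w))                      ≡⟨ cong (Δ vs g) (sym (⊕-assoc a v _)) ⟩
  Δ vs g ((a ⊕ v) ⊕ β v · w)                      ≡⟨ Δ-periodic periodic vs (β v) (a ⊕ v) ⟩
  Δ vs g (a ⊕ v)                                  ∎)
  where open ≡-Reasoning

Δ-shear : (g : F2^ n → Bool) (β : F2^ n → Bool) (w : F2^ n) (ws : Vec (F2^ n) k) (a : F2^ n) →
          Δ (w ∷ V.map (shear β w) ws) g a ≡ Δ (w ∷ ws) g a
Δ-shear g β w ws a = begin
  Δ (w ∷ V.map (shear β w) ws) g a    ≡⟨ Δ-∷ g w (V.map (shear β w) ws) a ⟩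
  Δ (V.map (shear β w) ws) (∂ w g) a  ≡⟨ Δ-map-shear (∂-periodic g w) β ws a ⟩
  Δ ws (∂ w g) a                      ≡⟨ sym (Δ-∷ g w ws a) ⟩
  Δ (w ∷ ws) g a                      ∎
  where open ≡-Reasoning

Δ-map-graph : (β : F2^ n → Bool) → IsLinearForm β → (g : F2^ (suc n) → Bool) (b : Bool)
              (vs : Vec (F2^ n) k) (a : F2^ n) →
              Δ (V.map (λ v → β v ∷ v) vs) g ((b xor β a) ∷ a) ≡ Δ vs (λ x → g ((b xor β x) ∷ x)) a
Δ-map-graph β β-linear g b []       a = refl
Δ-map-graph β β-linear g b (v ∷ vs) a = cong₂ _xor_ (Δ-map-graph β β-linear g b vs a) (begin
  Δ (V.map (λ v → β v ∷ v) vs) g (((b xor β a) xor β v) ∷ (a ⊕ v))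
    ≡⟨ cong (λ c → Δ (V.map (λ v → β v ∷ v) vs) g (c ∷ (a ⊕ v)))
            (trans (xor-assoc b (β a) (β v)) (cong (b xor_) (sym (β-linear a v)))) ⟩
  Δ (V.map (λ v → β v ∷ v) vs) g ((b xor β (a ⊕ v)) ∷ (a ⊕ v))
    ≡⟨ Δ-map-graph β β-linear g b vs (a ⊕ v) ⟩
  Δ vs (λ x → g ((b xor β x) ∷ x)) (a ⊕ v)
    ∎)
  where open ≡-Reasoning

Δ-map-false∷ : (g : F2^ (suc n) → Bool) (b : Bool) (vs : Vec (F2^ n) k) (a : F2^ n) →
               Δ (V.map (false ∷_) vs) g (b ∷ a) ≡ Δ vs (λ x → g (b ∷ x)) a
Δ-map-false∷ g true  = Δ-map-graph (λ _ → false) (λ _ _ → refl) g true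
Δ-map-false∷ g false = Δ-map-graph (λ _ → false) (λ _ _ → refl) g false

Δ-pivot : (g : F2^ (suc n) → Bool) (u : F2^ n) (ws : Vec (F2^ n) k) →
          Δ ((true ∷ u) ∷ V.map (false ∷_) ws) g 𝟎
            ≡ Δ ws (λ x → g (false ∷ x)) 𝟎 xor Δ ws (λ x → g (true ∷ x)) (𝟎 ⊕ u)
Δ-pivot g u ws = cong₂ _xor_ (Δ-map-false∷ g false ws 𝟎) (Δ-map-false∷ g true ws (𝟎 ⊕ u))

-- Algebraic degree

Affine : (F2^ n → Bool) → Set
Affine ℓ = ∀ w x y → ∂ w ℓ x ≡ ∂ w ℓ y

Affine-head : Affine (head {n = n})
Affine-head (w₀ ∷ w) (x₀ ∷ x) (y₀ ∷ y) =
  solve 3 (λ w x y → x :+ (x :+ w) := y :+ (y :+ w)) refl w₀ x₀ y₀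

Affine-shift : (ℓ : F2^ n → Bool) → Affine ℓ → ∀ a → Affine (λ x → ℓ (x ⊕ a))
Affine-shift ℓ ℓ-affine a w x y = begin
  ℓ (x ⊕ a) xor ℓ ((x ⊕ w) ⊕ a)  ≡⟨ cong (λ z → ℓ (x ⊕ a) xor ℓ z) (xy∙z≈xz∙y x w a) ⟩
  ∂ w ℓ (x ⊕ a)                  ≡⟨ ℓ-affine w (x ⊕ a) (y ⊕ a) ⟩
  ∂ w ℓ (y ⊕ a)                  ≡⟨ cong (λ z → ℓ (y ⊕ a) xor ℓ z) (xy∙z≈xz∙y y a w) ⟩
  ℓ (y ⊕ a) xor ℓ ((y ⊕ w) ⊕ a)  ∎
  where open ≡-Reasoning

data Deg< {n : ℕ} : ℕ → (F2^ n → Bool) → Set where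
  zero  : ∀ {d} → Deg< d (λ _ → false)
  const : ∀ {d} b → Deg< (suc d) (λ _ → b)
  _⊻_   : ∀ {d f g} → Deg< d f → Deg< d g → Deg< d (λ x → f x xor g x)
  mul   : ∀ {d f} ℓ → Affine ℓ → Deg< d f → Deg< (suc d) (λ x → f x ∧ ℓ x)
  ext   : ∀ {d f g} → (∀ x → f x ≡ g x) → Deg< d f → Deg< d g

Deg<-≡ : {f : F2^ n → Bool} {d′ : ℕ} → d ≡ d′ → Deg< d f → Deg< d′ f
Deg<-≡ refl p = p

Deg<0 : {f : F2^ n → Bool} → Deg< 0 f → ∀ x → f x ≡ false
Deg<0 zero      x = refl
Deg<0 (p ⊻ q)   x = cong₂ _xor_ (Deg<0 p x) (Deg<0 q x)
Deg<0 (ext e p) x = trans (sym (e x)) (Deg<0 p x)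

Deg<-∧ʳ : {f : F2^ n → Bool} → Deg< d f → ∀ b → Deg< d (λ x → f x ∧ b)
Deg<-∧ʳ         p true  = ext (λ x → sym (∧-identityʳ _)) p
Deg<-∧ʳ {f = f} p false = ext (λ x → sym (∧-zeroʳ (f x))) zero

Deg<-mul-pred : {f : F2^ n → Bool} → ∀ ℓ → Affine ℓ → Deg< (pred d) f → Deg< d (λ x → f x ∧ ℓ x)
Deg<-mul-pred {d = zero}  ℓ ℓ-affine p = ext (λ x → cong (_∧ ℓ x) (sym (Deg<0 p x))) zero
Deg<-mul-pred {d = suc d} ℓ ℓ-affine p = mul ℓ ℓ-affine p

Deg<-∘ : {f : F2^ n → Bool} (A : F2^ m → F2^ n) → (∀ ℓ → Affine ℓ → Affine (λ x → ℓ (A x))) →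
         Deg< d f → Deg< d (λ x → f (A x))
Deg<-∘ A affine∘A zero               = zero
Deg<-∘ A affine∘A (const b)          = const b
Deg<-∘ A affine∘A (p ⊻ q)            = Deg<-∘ A affine∘A p ⊻ Deg<-∘ A affine∘A q
Deg<-∘ A affine∘A (mul ℓ ℓ-affine p) =
  mul (λ x → ℓ (A x)) (affine∘A ℓ ℓ-affine) (Deg<-∘ A affine∘A p)
Deg<-∘ A affine∘A (ext e p)          = ext (λ x → e (A x)) (Deg<-∘ A affine∘A p)

Deg<-tail : {f : F2^ n → Bool} → Deg< d f → Deg< d (λ (x : F2^ (suc n)) → f (tail x))
Deg<-tail = Deg<-∘ tail (λ { ℓ ℓ-affine (w₀ ∷ w) (x₀ ∷ x) (y₀ ∷ y) → ℓ-affine w x y })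

Deg<-∂ : {f : F2^ n → Bool} → Deg< d f → ∀ w → Deg< (pred d) (∂ w f)
Deg<-∂ zero      w = zero
Deg<-∂ (const b) w = ext (λ x → sym (xor-same b)) zero
Deg<-∂ (_⊻_ {f = f} {g} p q) w = ext expand (Deg<-∂ p w ⊻ Deg<-∂ q w)
  where
  expand : ∀ x → ∂ w f x xor ∂ w g x ≡ ∂ w (λ x → f x xor g x) x
  expand x = solve 4 (λ p q r s → (p :+ r) :+ (q :+ s) := (p :+ q) :+ (r :+ s))
                   refl (f x) (g x) (f (x ⊕ w)) (g (x ⊕ w))
Deg<-∂ (mul {f = f} ℓ ℓ-affine p) w =
  ext expand (Deg<-mul-pred (λ x → ℓ (x ⊕ w)) (Affine-shift ℓ ℓ-affine w) (Deg<-∂ p w)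
              ⊻ Deg<-∧ʳ p (∂ w ℓ 𝟎))
  where
  open ≡-Reasoning
  expand : ∀ x → (∂ w f x ∧ ℓ (x ⊕ w)) xor (f x ∧ ∂ w ℓ 𝟎) ≡ ∂ w (λ x → f x ∧ ℓ x) x
  expand x = begin
    (∂ w f x ∧ ℓ (x ⊕ w)) xor (f x ∧ ∂ w ℓ 𝟎)
      ≡⟨ cong (λ c → (∂ w f x ∧ ℓ (x ⊕ w)) xor (f x ∧ c)) (ℓ-affine w 𝟎 x) ⟩
    (∂ w f x ∧ ℓ (x ⊕ w)) xor (f x ∧ ∂ w ℓ x)
      ≡⟨ solve 4 (λ p q r s → ((p :+ q) :* s) :+ (p :* (r :+ s)) := (p :* r) :+ (q :* s))
               refl (f x) (f (x ⊕ w)) (ℓ x) (ℓ (x ⊕ w)) ⟩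
    ∂ w (λ x → f x ∧ ℓ x) x
      ∎
Deg<-∂ (ext e p) w = ext (λ x → cong₂ _xor_ (e x) (e (x ⊕ w))) (Deg<-∂ p w)

monomial-Deg< : (I : F2^ n) → Deg< (suc (weight I)) (monomial I)
monomial-Deg< []          = ext (λ { [] → refl }) (const true)
monomial-Deg< (false ∷ I) = ext (λ { (x₀ ∷ x) → refl }) (Deg<-tail (monomial-Deg< I))
monomial-Deg< (true ∷ I)  =
  ext (λ { (x₀ ∷ x) → ∧-comm (monomial I x) x₀ }) (mul head Affine-head (Deg<-tail (monomial-Deg< I)))

Δ-vanishes : {f : F2^ n → Bool} → Deg< d f → d ≤ k → (vs : Vec (F2^ n) k) (a : F2^ n) →
             Δ vs f a ≡ false
Δ-vanishes         p z≤n []       a = Deg<0 p a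
Δ-vanishes {f = f} p d≤k (w ∷ ws) a =
  trans (Δ-∷ f w ws a) (Δ-vanishes (Deg<-∂ p w) (pred-mono-≤ d≤k) ws a)

xor≡false⇒≡ : ∀ p q → p xor q ≡ false → p ≡ q
xor≡false⇒≡ true  true  _ = refl
xor≡false⇒≡ false false _ = refl

Δ-≡-modulo-Deg< : {f g : F2^ n → Bool} → Deg< k (λ x → f x xor g x) →
                  (vs : Vec (F2^ n) k) (a : F2^ n) → Δ vs f a ≡ Δ vs g a
Δ-≡-modulo-Deg< {f = f} {g} p vs a =
  xor≡false⇒≡ _ _ (trans (sym (Δ-xor f g vs a)) (Δ-vanishes p ≤-refl vs a))

Δ-base-invariant : {f : F2^ n → Bool} → Deg< (suc k) f → (vs : Vec (F2^ n) k) (a : F2^ n) →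
                   Δ vs f a ≡ Δ vs f 𝟎
Δ-base-invariant {f = f} p vs a = begin
  Δ vs f a        ≡⟨ cong (Δ vs f) (sym (⊕-identityˡ a)) ⟩
  Δ vs f (𝟎 ⊕ a)  ≡⟨ sym (xor≡false⇒≡ _ _ (Δ-vanishes p ≤-refl (a ∷ vs) 𝟎)) ⟩
  Δ vs f 𝟎        ∎
  where open ≡-Reasoning

-- Plücker coordinates

∁ : F2^ n → F2^ n
∁ = V.map not

∁-involutive : (I : F2^ n) → ∁ (∁ I) ≡ I
∁-involutive []      = refl
∁-involutive (b ∷ I) = cong₂ _∷_ (not-involutive b) (∁-involutive I)

weight-∁ : (I : F2^ n) → weight (∁ I) + weight I ≡ n
weight-∁ []          = refl
weight-∁ (true ∷ I)  = trans (+-suc (weight (∁ I)) (weight I)) (cong suc (weight-∁ I))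
weight-∁ (false ∷ I) = cong suc (weight-∁ I)

weight-∁-≡ : (I : F2^ n) {e : ℕ} → weight I + e ≡ n → weight (∁ I) ≡ e
weight-∁-≡ I {e} wI+e≡n =
  +-cancelʳ-≡ (weight I) _ _ (trans (weight-∁ I) (trans (sym wI+e≡n) (+-comm (weight I) e)))

-- When weight I = k this is the minor on the columns I of the k × n matrix with rows vs.
plücker : F2^ n → Vec (F2^ n) k → Bool
plücker I vs = Δ vs (monomial I) 𝟎

plücker-base-invariant : (I : F2^ n) (vs : Vec (F2^ n) k) → weight I ≡ k → (a : F2^ n) →
                         Δ vs (monomial I) a ≡ plücker I vs
plücker-base-invariant I vs refl = Δ-base-invariant (monomial-Deg< I) vs

-- laplace I u g is the sum of g (I ∖ {j}) over the j ∈ I with u_j = 1.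
laplace : F2^ n → F2^ n → (F2^ n → Bool) → Bool
laplace []      []       g = false
laplace (i ∷ I) (u ∷ us) g = (i ∧ u ∧ g (false ∷ I)) xor laplace I us (λ J → g (i ∷ J))

laplace-false : (I u : F2^ n) → laplace I u (λ _ → false) ≡ false
laplace-false []      []       = refl
laplace-false (i ∷ I) (u ∷ us) =
  cong₂ _xor_ (trans (cong (i ∧_) (∧-zeroʳ u)) (∧-zeroʳ i)) (laplace-false I us)

laplace-∧ˡ : (I u : F2^ n) (b : Bool) (g : F2^ n → Bool) →
             laplace I u (λ J → b ∧ g J) ≡ b ∧ laplace I u g
laplace-∧ˡ I u true  g = refl
laplace-∧ˡ I u false g = laplace-false I u

laplace-xor : (I u : F2^ n) (g h : F2^ n → Bool) →
              laplace I u (λ J → g J xor h J) ≡ laplace I u g xor laplace I u h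
laplace-xor []      []       g h = refl
laplace-xor (i ∷ I) (u ∷ us) g h =
  trans (cong ((i ∧ u ∧ (g (false ∷ I) xor h (false ∷ I))) xor_)
              (laplace-xor I us (λ J → g (i ∷ J)) (λ J → h (i ∷ J))))
        (solve 6 (λ i u p q x y → (i :* (u :* (p :+ q))) :+ (x :+ y)
                               := ((i :* (u :* p)) :+ x) :+ ((i :* (u :* q)) :+ y))
               refl i u (g (false ∷ I)) (h (false ∷ I))
               (laplace I us (λ J → g (i ∷ J))) (laplace I us (λ J → h (i ∷ J))))

laplace-Δ : (I u : F2^ n) (G : F2^ n → F2^ n → Bool) (vs : Vec (F2^ n) k) (a : F2^ n) →
            laplace I u (λ J → Δ vs (G J) a) ≡ Δ vs (λ x → laplace I u (λ J → G J x)) a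
laplace-Δ I u G []       a = refl
laplace-Δ I u G (v ∷ vs) a =
  trans (laplace-xor I u (λ J → Δ vs (G J) a) (λ J → Δ vs (G J) (a ⊕ v)))
        (cong₂ _xor_ (laplace-Δ I u G vs a) (laplace-Δ I u G vs (a ⊕ v)))

laplace-cong : (I u : F2^ n) {g h : F2^ n → Bool} → (∀ J → suc (weight J) ≡ weight I → g J ≡ h J) →
               laplace I u g ≡ laplace I u h
laplace-cong []          []       g≡h = refl
laplace-cong (true ∷ I)  (u ∷ us) g≡h =
  cong₂ _xor_ (cong (u ∧_) (g≡h (false ∷ I) refl))
              (laplace-cong I us (λ J e → g≡h (true ∷ J) (cong suc e)))
laplace-cong (false ∷ I) (u ∷ us) g≡h = laplace-cong I us (λ J e → g≡h (false ∷ J) e)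

∂-monomial-Deg< : (I u : F2^ n) →
                  Deg< (pred (weight I)) (λ x → ∂ u (monomial I) x xor laplace I u (λ J → monomial J x))
∂-monomial-Deg< []          []       = ext (λ { [] → refl }) zero
∂-monomial-Deg< (false ∷ I) (u₀ ∷ u) = ext (λ { (x₀ ∷ x) → refl }) (Deg<-tail (∂-monomial-Deg< I u))
∂-monomial-Deg< (true ∷ I)  (u₀ ∷ u) = ext (λ { (x₀ ∷ x) → expand x₀ x })
  (Deg<-mul-pred head Affine-head (Deg<-tail (∂-monomial-Deg< I u))
   ⊻ Deg<-∧ʳ (Deg<-tail (Deg<-∂ (monomial-Deg< I) u)) u₀)
  where
  expand : ∀ x₀ x → (((monomial I x xor monomial I (x ⊕ u)) xor laplace I u (λ J → monomial J x)) ∧ x₀)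
                      xor ((monomial I x xor monomial I (x ⊕ u)) ∧ u₀)
                    ≡ ∂ (u₀ ∷ u) (monomial (true ∷ I)) (x₀ ∷ x)
                      xor laplace (true ∷ I) (u₀ ∷ u) (λ J → monomial J (x₀ ∷ x))
  expand x₀ x = begin
    (((xI xor xI′) xor l) ∧ x₀) xor ((xI xor xI′) ∧ u₀)
      ≡⟨ solve 5 (λ x₀ u₀ p q l → (((p :+ q) :+ l) :* x₀) :+ ((p :+ q) :* u₀)
                               := ((x₀ :* p) :+ ((x₀ :+ u₀) :* q)) :+ ((u₀ :* p) :+ (x₀ :* l)))
               refl x₀ u₀ xI xI′ l ⟩
    ((x₀ ∧ xI) xor ((x₀ xor u₀) ∧ xI′)) xor ((u₀ ∧ xI) xor (x₀ ∧ l))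
      ≡⟨ cong (λ z → ((x₀ ∧ xI) xor ((x₀ xor u₀) ∧ xI′)) xor ((u₀ ∧ xI) xor z))
              (sym (laplace-∧ˡ I u x₀ (λ J → monomial J x))) ⟩
    ((x₀ ∧ xI) xor ((x₀ xor u₀) ∧ xI′)) xor ((u₀ ∧ xI) xor laplace I u (λ J → x₀ ∧ monomial J x))
      ∎
    where
    open ≡-Reasoning
    xI xI′ l : Bool
    xI  = monomial I x
    xI′ = monomial I (x ⊕ u)
    l   = laplace I u (λ J → monomial J x)

dot-monomial-Deg< : (K u : F2^ n) →
                    Deg< (suc (weight K))
                         (λ x → (dot u x ∧ monomial K x) xor laplace (∁ K) u (λ J → monomial (∁ J) x))
dot-monomial-Deg< []          []       = ext (λ { [] → refl }) zero
dot-monomial-Deg< (true ∷ K)  (u₀ ∷ u) = ext (λ { (x₀ ∷ x) → expand x₀ x })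
  (mul head Affine-head (Deg<-tail (dot-monomial-Deg< K u)) ⊻ Deg<-∧ʳ (monomial-Deg< (true ∷ K)) u₀)
  where
  expand : ∀ x₀ x → ((((dot u x ∧ monomial K x) xor laplace (∁ K) u (λ J → monomial (∁ J) x)) ∧ x₀)
                      xor ((x₀ ∧ monomial K x) ∧ u₀))
                    ≡ (dot (u₀ ∷ u) (x₀ ∷ x) ∧ monomial (true ∷ K) (x₀ ∷ x))
                      xor laplace (∁ (true ∷ K)) (u₀ ∷ u) (λ J → monomial (∁ J) (x₀ ∷ x))
  expand x₀ x = begin
    (((ux ∧ xK) xor l) ∧ x₀) xor ((x₀ ∧ xK) ∧ u₀)
      ≡⟨ cong (λ y → (((ux ∧ xK) xor l) ∧ x₀) xor ((y ∧ xK) ∧ u₀)) (sym (∧-idem x₀)) ⟩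
    (((ux ∧ xK) xor l) ∧ x₀) xor (((x₀ ∧ x₀) ∧ xK) ∧ u₀)
      ≡⟨ solve 5 (λ u₀ x₀ ux p l → (((ux :* p) :+ l) :* x₀) :+ (((x₀ :* x₀) :* p) :* u₀)
                                := (((u₀ :* x₀) :+ ux) :* (x₀ :* p)) :+ (x₀ :* l))
               refl u₀ x₀ ux xK l ⟩
    (((u₀ ∧ x₀) xor ux) ∧ (x₀ ∧ xK)) xor (x₀ ∧ l)
      ≡⟨ cong ((((u₀ ∧ x₀) xor ux) ∧ (x₀ ∧ xK)) xor_)
              (sym (laplace-∧ˡ (∁ K) u x₀ (λ J → monomial (∁ J) x))) ⟩
    (((u₀ ∧ x₀) xor ux) ∧ (x₀ ∧ xK)) xor laplace (∁ K) u (λ J → x₀ ∧ monomial (∁ J) x)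
      ∎
    where
    open ≡-Reasoning
    ux xK l : Bool
    ux = dot u x
    xK = monomial K x
    l  = laplace (∁ K) u (λ J → monomial (∁ J) x)
dot-monomial-Deg< (false ∷ K) (u₀ ∷ u) = ext (λ { (x₀ ∷ x) → expand x₀ x }) (Deg<-tail (dot-monomial-Deg< K u))
  where
  expand : ∀ x₀ x → (dot u x ∧ monomial K x) xor laplace (∁ K) u (λ J → monomial (∁ J) x)
                    ≡ (dot (u₀ ∷ u) (x₀ ∷ x) ∧ monomial (false ∷ K) (x₀ ∷ x))
                      xor laplace (∁ (false ∷ K)) (u₀ ∷ u) (λ J → monomial (∁ J) (x₀ ∷ x))
  expand x₀ x = begin
    (ux ∧ xK) xor l
      ≡⟨ solve 5 (λ u₀ x₀ ux p l → (ux :* p) :+ l := (((u₀ :* x₀) :+ ux) :* p) :+ ((u₀ :* (x₀ :* p)) :+ l))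
               refl u₀ x₀ ux xK l ⟩
    (((u₀ ∧ x₀) xor ux) ∧ xK) xor ((u₀ ∧ (x₀ ∧ xK)) xor l)
      ≡⟨ cong (λ L → (((u₀ ∧ x₀) xor ux) ∧ xK) xor ((u₀ ∧ (x₀ ∧ monomial L x)) xor l))
              (sym (∁-involutive K)) ⟩
    (((u₀ ∧ x₀) xor ux) ∧ xK) xor ((u₀ ∧ (x₀ ∧ monomial (∁ (∁ K)) x)) xor l)
      ∎
    where
    open ≡-Reasoning
    ux xK l : Bool
    ux = dot u x
    xK = monomial K x
    l  = laplace (∁ K) u (λ J → monomial (∁ J) x)

plücker-laplace : (I u : F2^ n) (ws : Vec (F2^ n) k) → weight I ≡ suc k →
                  plücker I (u ∷ ws) ≡ laplace I u (λ J → plücker J ws)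
plücker-laplace {k = k} I u ws wI = begin
  plücker I (u ∷ ws)                               ≡⟨ Δ-∷ (monomial I) u ws 𝟎 ⟩
  Δ ws (∂ u (monomial I)) 𝟎                        ≡⟨ Δ-≡-modulo-Deg< taylor ws 𝟎 ⟩
  Δ ws (λ x → laplace I u (λ J → monomial J x)) 𝟎  ≡⟨ sym (laplace-Δ I u monomial ws 𝟎) ⟩
  laplace I u (λ J → plücker J ws)                 ∎
  where
  open ≡-Reasoning
  taylor : Deg< k (λ x → ∂ u (monomial I) x xor laplace I u (λ J → monomial J x))
  taylor = Deg<-≡ (cong pred wI) (∂-monomial-Deg< I u)

Δ-dot-monomial : (K u : F2^ n) (vs : Vec (F2^ n) k) → suc (weight K) ≡ k →
                 Δ vs (λ x → dot u x ∧ monomial K x) 𝟎 ≡ laplace (∁ K) u (λ J → plücker (∁ J) vs)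
Δ-dot-monomial K u vs refl = begin
  Δ vs (λ x → dot u x ∧ monomial K x) 𝟎
    ≡⟨ Δ-≡-modulo-Deg< (dot-monomial-Deg< K u) vs 𝟎 ⟩
  Δ vs (λ x → laplace (∁ K) u (λ J → monomial (∁ J) x)) 𝟎
    ≡⟨ sym (laplace-Δ (∁ K) u (λ J → monomial (∁ J)) vs 𝟎) ⟩
  laplace (∁ K) u (λ J → plücker (∁ J) vs)
    ∎
  where open ≡-Reasoning

-- Complementary Plücker duals

record PlückerDual {n d : ℕ} (ws : Vec (F2^ n) d) (e : ℕ) : Set where
  constructor plückerDual
  field
    vectors     : Vec (F2^ n) e
    independent : LinIndep vectors
    plücker-∁   : ∀ I → weight I ≡ d → plücker I ws ≡ plücker (∁ I) vectors

PlückerDual-sym : {ws : Vec (F2^ n) d} {e : ℕ} → d + e ≡ n → (D : PlückerDual ws e) →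
                  ∀ I → weight I ≡ e → plücker I (PlückerDual.vectors D) ≡ plücker (∁ I) ws
PlückerDual-sym {d = d} {ws} {e} d+e≡n (plückerDual vs _ rel) I refl = begin
  plücker I vs          ≡⟨ cong (λ J → plücker J vs) (sym (∁-involutive I)) ⟩
  plücker (∁ (∁ I)) vs  ≡⟨ sym (rel (∁ I) (weight-∁-≡ I (trans (+-comm e d) d+e≡n))) ⟩
  plücker (∁ I) ws      ∎
  where open ≡-Reasoning

PlückerDual-resp : {ws ws′ : Vec (F2^ n) d} {e : ℕ} → (∀ I → plücker I ws ≡ plücker I ws′) →
                   PlückerDual ws′ e → PlückerDual ws e
PlückerDual-resp same (plückerDual vs ind rel) = plückerDual vs ind (λ I wI → trans (same I) (rel I wI))

dual-zeroColumn : {ws : Vec (F2^ n) d} {e : ℕ} → PlückerDual ws e →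
                  PlückerDual (V.map (false ∷_) ws) (suc e)
dual-zeroColumn {n = n} {d = d} {ws = ws} (plückerDual vs ind rel) =
  plückerDual (e₁ ∷ V.map (false ∷_) vs) ind′ rel′
  where
  open ≡-Reasoning
  e₁ : F2^ (suc n)
  e₁ = true ∷ 𝟎
  ind′ : LinIndep (e₁ ∷ V.map (false ∷_) vs)
  ind′ (c₀ ∷ c) eq = by-c₀ c₀ (trans (cong (c₀ · e₁ ⊕_) (sym (linComb-map (λ _ _ → refl) c vs))) eq)
    where
    by-c₀ : ∀ c₀ → c₀ · e₁ ⊕ (false ∷ linComb c vs) ≡ 𝟎 → c₀ ∷ c ≡ 𝟎
    by-c₀ false eq′ = cong (false ∷_) (ind c (trans (sym (⊕-identityˡ _)) (cong tail eq′)))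
    by-c₀ true  ()
  rel′ : ∀ I → weight I ≡ d →
         plücker I (V.map (false ∷_) ws) ≡ plücker (∁ I) (e₁ ∷ V.map (false ∷_) vs)
  rel′ (false ∷ I) wI = begin
    plücker (false ∷ I) (V.map (false ∷_) ws)
      ≡⟨ Δ-map-false∷ (monomial (false ∷ I)) false ws 𝟎 ⟩
    plücker I ws
      ≡⟨ rel I wI ⟩
    plücker (∁ I) vs
      ≡⟨ cong (Δ vs (monomial (∁ I))) (sym (⊕-identityˡ 𝟎)) ⟩
    Δ vs (monomial (∁ I)) (𝟎 ⊕ 𝟎)
      ≡⟨ cong (_xor Δ vs (monomial (∁ I)) (𝟎 ⊕ 𝟎)) (sym (Δ-false vs 𝟎)) ⟩
    Δ vs (λ _ → false) 𝟎 xor Δ vs (monomial (∁ I)) (𝟎 ⊕ 𝟎)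
      ≡⟨ sym (Δ-pivot (monomial (true ∷ ∁ I)) 𝟎 vs) ⟩
    plücker (true ∷ ∁ I) (e₁ ∷ V.map (false ∷_) vs)
      ∎
  rel′ (true ∷ I) wI = begin
    plücker (true ∷ I) (V.map (false ∷_) ws)
      ≡⟨ Δ-map-false∷ (monomial (true ∷ I)) false ws 𝟎 ⟩
    Δ ws (λ _ → false) 𝟎
      ≡⟨ Δ-false ws 𝟎 ⟩
    false
      ≡⟨ sym (xor-same (plücker (∁ I) vs)) ⟩
    plücker (∁ I) vs xor plücker (∁ I) vs
      ≡⟨ cong (λ a → plücker (∁ I) vs xor Δ vs (monomial (∁ I)) a) (sym (⊕-identityˡ 𝟎)) ⟩
    plücker (∁ I) vs xor Δ vs (monomial (∁ I)) (𝟎 ⊕ 𝟎)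
      ≡⟨ sym (Δ-pivot (monomial (false ∷ ∁ I)) 𝟎 vs) ⟩
    plücker (false ∷ ∁ I) (e₁ ∷ V.map (false ∷_) vs)
      ∎

dual-pivotColumn : (u : F2^ n) {ws : Vec (F2^ n) d} {e : ℕ} → suc d + e ≡ suc n → PlückerDual ws e →
                   PlückerDual ((true ∷ u) ∷ V.map (false ∷_) ws) e
dual-pivotColumn {n = n} {d = d} u {ws} {e} d+e≡n (plückerDual vs ind rel) =
  plückerDual (V.map graph vs) ind′ rel′
  where
  open ≡-Reasoning
  graph : F2^ n → F2^ (suc n)
  graph v = dot u v ∷ v
  ind′ : LinIndep (V.map graph vs)
  ind′ = LinIndep-map (λ x y → cong (_∷ (x ⊕ y)) (dot-linear u x y)) (λ x → cong tail) ind
  Δ-graph : (g : F2^ (suc n) → Bool) → Δ (V.map graph vs) g 𝟎 ≡ Δ vs (λ x → g (dot u x ∷ x)) 𝟎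
  Δ-graph g = trans (cong (λ b → Δ (V.map graph vs) g (b ∷ 𝟎)) (sym (linearForm-𝟎 (dot u) (dot-linear u))))
                    (Δ-map-graph (dot u) (dot-linear u) g false vs 𝟎)
  rel′ : ∀ I → weight I ≡ suc d →
         plücker I ((true ∷ u) ∷ V.map (false ∷_) ws) ≡ plücker (∁ I) (V.map graph vs)
  rel′ (true ∷ I) wI = begin
    plücker (true ∷ I) ((true ∷ u) ∷ V.map (false ∷_) ws)
      ≡⟨ Δ-pivot (monomial (true ∷ I)) u ws ⟩
    Δ ws (λ _ → false) 𝟎 xor Δ ws (monomial I) (𝟎 ⊕ u)
      ≡⟨ cong (_xor Δ ws (monomial I) (𝟎 ⊕ u)) (Δ-false ws 𝟎) ⟩
    Δ ws (monomial I) (𝟎 ⊕ u)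
      ≡⟨ plücker-base-invariant I ws (suc-injective wI) (𝟎 ⊕ u) ⟩
    plücker I ws
      ≡⟨ rel I (suc-injective wI) ⟩
    plücker (∁ I) vs
      ≡⟨ sym (Δ-graph (monomial (false ∷ ∁ I))) ⟩
    plücker (false ∷ ∁ I) (V.map graph vs)
      ∎
  rel′ (false ∷ I) wI = begin
    plücker (false ∷ I) ((true ∷ u) ∷ V.map (false ∷_) ws)
      ≡⟨ Δ-pivot (monomial (false ∷ I)) u ws ⟩
    plücker I (u ∷ ws)
      ≡⟨ plücker-laplace I u ws wI ⟩
    laplace I u (λ J → plücker J ws)
      ≡⟨ laplace-cong I u (λ J e → rel J (suc-injective (trans e wI))) ⟩
    laplace I u (λ J → plücker (∁ J) vs)
      ≡⟨ cong (λ K → laplace K u (λ J → plücker (∁ J) vs)) (sym (∁-involutive I)) ⟩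
    laplace (∁ (∁ I)) u (λ J → plücker (∁ J) vs)
      ≡⟨ sym (Δ-dot-monomial (∁ I) u vs (weight-∁-≡ (false ∷ I) (trans (cong (_+ e) wI) d+e≡n))) ⟩
    Δ vs (λ x → dot u x ∧ monomial (∁ I) x) 𝟎
      ≡⟨ sym (Δ-graph (monomial (true ∷ ∁ I))) ⟩
    plücker (true ∷ ∁ I) (V.map graph vs)
      ∎

record PivotForm {n d : ℕ} (ws : Vec (F2^ (suc n)) (suc d)) : Set where
  constructor pivotForm
  field
    pivot       : F2^ n
    rest        : Vec (F2^ n) d
    independent : LinIndep rest
    plücker-≡   : ∀ I → plücker I ws ≡ plücker I ((true ∷ pivot) ∷ V.map (false ∷_) rest)

PivotForm-resp : {ws ws′ : Vec (F2^ (suc n)) (suc d)} → (∀ I → plücker I ws ≡ plücker I ws′) →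
                 PivotForm ws′ → PivotForm ws
PivotForm-resp same (pivotForm u rest ind same′) = pivotForm u rest ind (λ I → trans (same I) (same′ I))

PivotForm-head-true : (u : F2^ n) (ws : Vec (F2^ (suc n)) d) → LinIndep ((true ∷ u) ∷ ws) →
                      PivotForm ((true ∷ u) ∷ ws)
PivotForm-head-true {n = n} u ws ind = pivotForm u (V.map clear ws) ind′ same
  where
  clear : F2^ (suc n) → F2^ n
  clear v = tail v ⊕ head v · u
  sheared : V.map (shear head (true ∷ u)) ws ≡ V.map (false ∷_) (V.map clear ws)
  sheared = trans (map-cong (λ { (true ∷ v) → refl ; (false ∷ v) → refl }) ws) (map-∘ (false ∷_) clear ws)
  ind′ : LinIndep (V.map clear ws)
  ind′ = LinIndep-map⁻ (λ _ _ → refl) (LinIndep-∷⁻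
           (subst (λ vs → LinIndep ((true ∷ u) ∷ vs)) sheared (LinIndep-shear head-linear ind)))
  same : ∀ I → plücker I ((true ∷ u) ∷ ws) ≡ plücker I ((true ∷ u) ∷ V.map (false ∷_) (V.map clear ws))
  same I = trans (sym (Δ-shear (monomial I) head (true ∷ u) ws 𝟎))
                 (cong (λ vs → plücker I ((true ∷ u) ∷ vs)) sheared)

PivotForm-of-combination : (w : F2^ (suc n)) (ws : Vec (F2^ (suc n)) d) → LinIndep (w ∷ ws) →
                           (t : F2^ (suc d)) → head (linComb t (w ∷ ws)) ≡ true → PivotForm (w ∷ ws)
PivotForm-of-combination (true ∷ u)  ws ind t h = PivotForm-head-true u ws ind
PivotForm-of-combination {n = n} (false ∷ w) ws ind (t₀ ∷ t) h =
  PivotForm-resp same (PivotForm-head-true (w ⊕ tail x) ws ind′)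
  where
  x : F2^ (suc n)
  x = linComb t ws
  zero-head : ∀ b → head (b · (false ∷ w)) ≡ false
  zero-head true  = refl
  zero-head false = refl
  head-x : head x ≡ true
  head-x = trans (cong (_xor head x) (sym (zero-head t₀))) (trans (sym (head-linear (t₀ · (false ∷ w)) x)) h)
  add-head-true : ∀ y → head y ≡ true → (false ∷ w) ⊕ y ≡ true ∷ (w ⊕ tail y)
  add-head-true (true ∷ y) refl = refl
  ind′ : LinIndep ((true ∷ (w ⊕ tail x)) ∷ ws)
  ind′ = subst (λ v → LinIndep (v ∷ ws)) (add-head-true x head-x) (LinIndep-add t ind)
  same : ∀ I → plücker I ((false ∷ w) ∷ ws) ≡ plücker I ((true ∷ (w ⊕ tail x)) ∷ ws)
  same I = trans (sym (Δ-add (monomial I) (false ∷ w) t ws 𝟎))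
                 (cong (λ v → plücker I (v ∷ ws)) (add-head-true x head-x))

zeroColumn-or-combination : (ws : Vec (F2^ (suc n)) d) →
                            (∃[ ws′ ] ws ≡ V.map (false ∷_) ws′) ⊎ (∃[ t ] head (linComb t ws) ≡ true)
zeroColumn-or-combination []                = inj₁ ([] , refl)
zeroColumn-or-combination ((true ∷ u) ∷ ws) =
  inj₂ (true ∷ 𝟎 , cong (head ∘ ((true ∷ u) ⊕_)) (linComb-𝟎 ws))
zeroColumn-or-combination ((false ∷ w) ∷ ws) with zeroColumn-or-combination ws
... | inj₁ (ws′ , ws≡) = inj₁ (w ∷ ws′ , cong ((false ∷ w) ∷_) ws≡)
... | inj₂ (t , h)     = inj₂ (false ∷ t , trans (cong head (⊕-identityˡ (linComb t ws))) h)

duality : (ws : Vec (F2^ n) d) → LinIndep ws → ∃[ e ] (d + e ≡ n × PlückerDual ws e)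
duality {n = zero} []       _   = 0 , refl , plückerDual [] (λ { [] _ → refl }) (λ { [] _ → refl })
duality {n = zero} (w ∷ ws) ind with ind (true ∷ 𝟎) (F2^0-trivial _ _)
... | ()
duality {n = suc n} ws ind with zeroColumn-or-combination ws
... | inj₁ (ws′ , refl) =
  let e , d+e≡n , D = duality ws′ (LinIndep-map⁻ (λ _ _ → refl) ind)
  in  suc e , trans (+-suc _ e) (cong suc d+e≡n) , dual-zeroColumn D
duality {n = suc n} []       ind | inj₂ ([] , ())
duality {n = suc n} (w ∷ ws) ind | inj₂ (t , h) =
  let pivotForm u rest rest-indep same = PivotForm-of-combination w ws ind t h
      e , d+e≡n , D                   = duality rest rest-indep
  in  e , cong suc d+e≡n , PlückerDual-resp same (dual-pivotColumn u (cong suc d+e≡n) D)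

plückerDual-of-codim : (ws : Vec (F2^ n) d) → LinIndep ws → {e : ℕ} → d + e ≡ n → PlückerDual ws e
plückerDual-of-codim {d = d} ws ind d+e≡n =
  let e′ , d+e′≡n , D = duality ws ind
  in  subst (PlückerDual ws) (+-cancelˡ-≡ d _ _ (trans d+e′≡n (sym d+e≡n))) D

-- Flat sums of (n, m)-functions

⨁ : List Bool → Bool
⨁ = foldr _xor_ false

⨁-++ : (xs ys : List Bool) → ⨁ (xs ++ ys) ≡ ⨁ xs xor ⨁ ys
⨁-++ []       ys = refl
⨁-++ (x ∷ xs) ys = trans (cong (x xor_) (⨁-++ xs ys)) (sym (xor-assoc x (⨁ xs) (⨁ ys)))

⨁-allVecs-suc : (h : F2^ (suc k) → Bool) →
                ⨁ (L.map h (allVecs (suc k)))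
                  ≡ ⨁ (L.map (h ∘ (false ∷_)) (allVecs k)) xor ⨁ (L.map (h ∘ (true ∷_)) (allVecs k))
⨁-allVecs-suc {k = k} h = begin
  ⨁ (L.map h (L.map (false ∷_) A ++ L.map (true ∷_) A))
    ≡⟨ cong ⨁ (LP.map-++ h (L.map (false ∷_) A) _) ⟩
  ⨁ (L.map h (L.map (false ∷_) A) ++ L.map h (L.map (true ∷_) A))
    ≡⟨ ⨁-++ (L.map h (L.map (false ∷_) A)) _ ⟩
  ⨁ (L.map h (L.map (false ∷_) A)) xor ⨁ (L.map h (L.map (true ∷_) A))
    ≡⟨ sym (cong₂ (λ xs ys → ⨁ xs xor ⨁ ys) (LP.map-∘ A) (LP.map-∘ A)) ⟩
  ⨁ (L.map (h ∘ (false ∷_)) A) xor ⨁ (L.map (h ∘ (true ∷_)) A)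
    ∎
  where
  open ≡-Reasoning
  A : List (F2^ k)
  A = allVecs k

⨁-∁ : (h : F2^ n → Bool) → ⨁ (L.map h (allVecs n)) ≡ ⨁ (L.map (h ∘ ∁) (allVecs n))
⨁-∁ {n = zero}  h = refl
⨁-∁ {n = suc n} h = begin
  ⨁ (L.map h (allVecs (suc n)))
    ≡⟨ ⨁-allVecs-suc h ⟩
  ⨁ (L.map (h ∘ (false ∷_)) A) xor ⨁ (L.map (h ∘ (true ∷_)) A)
    ≡⟨ cong₂ _xor_ (⨁-∁ (h ∘ (false ∷_))) (⨁-∁ (h ∘ (true ∷_))) ⟩
  ⨁ (L.map (h ∘ (false ∷_) ∘ ∁) A) xor ⨁ (L.map (h ∘ (true ∷_) ∘ ∁) A)
    ≡⟨ xor-comm (⨁ (L.map (h ∘ (false ∷_) ∘ ∁) A)) (⨁ (L.map (h ∘ (true ∷_) ∘ ∁) A)) ⟩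
  ⨁ (L.map (h ∘ ∁ ∘ (false ∷_)) A) xor ⨁ (L.map (h ∘ ∁ ∘ (true ∷_)) A)
    ≡⟨ sym (⨁-allVecs-suc (h ∘ ∁)) ⟩
  ⨁ (L.map (h ∘ ∁) (allVecs (suc n)))
    ∎
  where
  open ≡-Reasoning
  A : List (F2^ n)
  A = allVecs n

Δ-⨁ : {A : Set} (h : A → F2^ n → Bool) (xs : List A) (vs : Vec (F2^ n) k) (a : F2^ n) →
      Δ vs (λ x → ⨁ (L.map (λ i → h i x) xs)) a ≡ ⨁ (L.map (λ i → Δ vs (h i) a) xs)
Δ-⨁ h []       vs a = Δ-false vs a
Δ-⨁ h (i ∷ xs) vs a =
  trans (Δ-xor (h i) (λ x → ⨁ (L.map (λ i → h i x) xs)) vs a) (cong (Δ vs (h i) a xor_) (Δ-⨁ h xs vs a))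

⨁-flat : (g : F2^ n → Bool) (vs : Vec (F2^ n) k) (a : F2^ n) →
         ⨁ (L.map (λ c → g (a ⊕ linComb c vs)) (allVecs k)) ≡ Δ vs g a
⨁-flat g []       a = trans (xor-identityʳ _) (cong g (⊕-identityʳ a))
⨁-flat g (w ∷ ws) a = trans (⨁-allVecs-suc (λ c → g (a ⊕ linComb c (w ∷ ws)))) (cong₂ _xor_
  (trans (cong ⨁ (LP.map-cong (λ c → cong (λ y → g (a ⊕ y)) (⊕-identityˡ (linComb c ws))) (allVecs _)))
         (⨁-flat g ws a))
  (trans (cong ⨁ (LP.map-cong (λ c → cong g (sym (⊕-assoc a w (linComb c ws)))) (allVecs _)))
         (⨁-flat g ws (a ⊕ w))))

vsum-∷ : {A : Set} (g : A → Bool) (G : A → F2^ m) (xs : List A) →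
         vsum (L.map (λ i → g i ∷ G i) xs) ≡ ⨁ (L.map g xs) ∷ vsum (L.map G xs)
vsum-∷ g G []       = refl
vsum-∷ g G (i ∷ xs) = cong ((g i ∷ G i) ⊕_) (vsum-∷ g G xs)

flatSum-∷ : (f : ANF n) (F : VFun n m) (a : F2^ n) (vs : Vec (F2^ n) k) →
            flatSum (f ∷ F) a vs ≡ Δ vs (evalANF f) a ∷ flatSum F a vs
flatSum-∷ {k = k} f F a vs =
  trans (vsum-∷ (λ c → evalANF f (a ⊕ linComb c vs)) (λ c → eval F (a ⊕ linComb c vs)) (allVecs k))
        (cong (_∷ flatSum F a vs) (⨁-flat (evalANF f) vs a))

Δ-evalANF : (f : ANF n) (vs : Vec (F2^ n) k) (a : F2^ n) →
            Δ vs (evalANF f) a ≡ ⨁ (L.map (λ I → f I ∧ Δ vs (monomial I) a) (allVecs n))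
Δ-evalANF {n = n} f vs a =
  trans (Δ-⨁ (λ I x → f I ∧ monomial I x) (allVecs n) vs a)
        (cong ⨁ (LP.map-cong (λ I → Δ-∧ˡ (f I) (monomial I) vs a) (allVecs n)))

Δ-evalANF-complement : (f : ANF n) (vs : Vec (F2^ n) k) (a : F2^ n) {k′ : ℕ} (ws : Vec (F2^ n) k′) (b : F2^ n) →
                       (∀ I → f I ≡ true → Δ vs (monomial I) a ≡ Δ ws (monomial (∁ I)) b) →
                       Δ vs (evalANF f) a ≡ Δ ws (evalANF (complANF f)) b
Δ-evalANF-complement {n = n} f vs a ws b same = begin
  Δ vs (evalANF f) a
    ≡⟨ Δ-evalANF f vs a ⟩
  ⨁ (L.map (λ I → f I ∧ Δ vs (monomial I) a) A)
    ≡⟨ cong ⨁ (LP.map-cong on-support A) ⟩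
  ⨁ (L.map (λ I → f I ∧ Δ ws (monomial (∁ I)) b) A)
    ≡⟨ cong ⨁ (LP.map-cong (λ I → cong (λ J → f J ∧ Δ ws (monomial (∁ I)) b) (sym (∁-involutive I)))
                           A) ⟩
  ⨁ (L.map (λ I → f (∁ (∁ I)) ∧ Δ ws (monomial (∁ I)) b) A)
    ≡⟨ sym (⨁-∁ (λ J → f (∁ J) ∧ Δ ws (monomial J) b)) ⟩
  ⨁ (L.map (λ J → f (∁ J) ∧ Δ ws (monomial J) b) A)
    ≡⟨ sym (Δ-evalANF (complANF f) ws b) ⟩
  Δ ws (evalANF (complANF f)) b
    ∎
  where
  open ≡-Reasoning
  A : List (F2^ n)
  A = allVecs n
  on-support : ∀ I → f I ∧ Δ vs (monomial I) a ≡ f I ∧ Δ ws (monomial (∁ I)) b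
  on-support I with f I in fI
  ... | true  = same I fI
  ... | false = refl

flatSum-complement : {F : VFun n m} → Homogeneous k F → (vs : Vec (F2^ n) d) (a : F2^ n)
                     {d′ : ℕ} (ws : Vec (F2^ n) d′) (b : F2^ n) →
                     (∀ I → weight I ≡ k → Δ vs (monomial I) a ≡ Δ ws (monomial (∁ I)) b) →
                     flatSum F a vs ≡ flatSum (complement F) b ws
flatSum-complement {F = []}    hom vs a ws b same = F2^0-trivial _ _
flatSum-complement {F = f ∷ F} hom vs a ws b same = begin
  flatSum (f ∷ F) a vs
    ≡⟨ flatSum-∷ f F a vs ⟩
  Δ vs (evalANF f) a ∷ flatSum F a vs
    ≡⟨ cong₂ _∷_ (Δ-evalANF-complement f vs a ws b (λ I fI → same I (hom zero I fI)))
                 (flatSum-complement (λ j → hom (suc j)) vs a ws b same) ⟩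
  Δ ws (evalANF (complANF f)) b ∷ flatSum (complement F) b ws
    ≡⟨ sym (flatSum-∷ (complANF f) (complement F) b ws) ⟩
  flatSum (complement (f ∷ F)) b ws
    ∎
  where open ≡-Reasoning

flatSum-dual : {F : VFun n m} → Homogeneous k F → {e : ℕ} → k + e ≡ n →
               (vs : Vec (F2^ n) k) (ws : Vec (F2^ n) e) →
               (∀ I → weight I ≡ k → plücker I vs ≡ plücker (∁ I) ws) →
               ∀ a b → flatSum F a vs ≡ flatSum (complement F) b ws
flatSum-dual hom {e} k+e≡n vs ws dual a b = flatSum-complement hom vs a ws b λ I wI → begin
  Δ vs (monomial I) a      ≡⟨ plücker-base-invariant I vs wI a ⟩
  plücker I vs             ≡⟨ dual I wI ⟩
  plücker (∁ I) ws         ≡⟨ sym (plücker-base-invariant (∁ I) ws (weight-∁-≡ I (trans (cong (_+ e) wI) k+e≡n)) b) ⟩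
  Δ ws (monomial (∁ I)) b  ∎
  where open ≡-Reasoning

theorem5p15 : (n m k : ℕ) → 1 ≤ n → k ≤ n → (F : VFun n m) → Homogeneous k F →
    SumFree k F ⇔ SumFree (n ∸ k) (complement F)
theorem5p15 n m k _ k≤n F hom = mk⇔ to from
  where
  k+[n∸k]≡n : k + (n ∸ k) ≡ n
  k+[n∸k]≡n = m+[n∸m]≡n k≤n
  [n∸k]+k≡n : (n ∸ k) + k ≡ n
  [n∸k]+k≡n = m∸n+n≡m k≤n

  to : SumFree k F → SumFree (n ∸ k) (complement F)
  to sumFree b ws ws-indep vanishing = sumFree 𝟎 vs vs-indep
    (trans (flatSum-dual hom k+[n∸k]≡n vs ws (PlückerDual-sym [n∸k]+k≡n D) 𝟎 b) vanishing)
    where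
    D : PlückerDual ws k
    D = plückerDual-of-codim ws ws-indep [n∸k]+k≡n
    open PlückerDual D renaming (vectors to vs; independent to vs-indep)

  from : SumFree (n ∸ k) (complement F) → SumFree k F
  from sumFree a vs vs-indep vanishing = sumFree 𝟎 ws ws-indep
    (trans (sym (flatSum-dual hom k+[n∸k]≡n vs ws (PlückerDual.plücker-∁ D) a 𝟎)) vanishing)
    where
    D : PlückerDual vs (n ∸ k)
    D = plückerDual-of-codim vs vs-indep k+[n∸k]≡n
    open PlückerDual D renaming (vectors to ws; independent to ws-indep)
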